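{- Let $(A,V)$ and $(B,W)$ be permutation groups on finite sets with $A,B\in DGR\setminus(GR\cup\{I_2\})$. Suppose there exists $a\in A'=\bar{A}\setminus A$ which pairs every pair of distinct paired Or-orbitals of $A$, and there exists $b\in B'=\bar{B}\setminus B$ which pairs every pair of distinct paired Or-orbitals of $B$. Then $A\times B\notin GR$. Moreover, $A\times B$ is transitive on $V\times W$.
   Context: A permutation group $(A,V)$ is a group $A$ of permutations of a set $V$; $I_n$ denotes the trivial group acting on an $n$-element set; groups are considered up to permutation isomorphism. The direct product $A\times B$ acts on $V\times W$ by $(a,b)(x,y)=(a(x),b(y))$. An edge-colored graph on a set $U$ is a function $E$ from the 2-element subsets of $U$ to a finite set of colors, with automorphisms the permutations $\sigma$ of $U$ satisfying $E(\{\sigma(u),\sigma(u')\})=E(\{u,u'\})$ for all distinct $u,u'$; an edge-colored digraph is defined the same way with ordered pairs $(u,u')$, $u\neq u'$, in place of 2-element subsets. $GR$ (resp. $DGR$) is the class of permutation groups that equal the full automorphism group of some edge-colored graph (resp. digraph) on their underlying set. NOr-orbitals of $(A,V)$ are the orbits of $A$ on 2-element subsets of $V$; Or-orbitals are the orbits of $A$ on ordered pairs $(v,v')$ of distinct elements of $V$ under $a(v,v')=(a(v),a(v'))$. $\bar{A}$ is the smallest permutation group on $V$ containing $A$ and belonging to $GR$ (equivalently, all permutations of $V$ mapping every NOr-orbital of $A$ onto itself); similarly for $\bar{B}$. Or-orbitals $O_1,O_2$ are paired if $O_2=\{(v',v):(v,v')\in O_1\}$. A permutation $\sigma$ pairs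 $O_1$ and $O_2$ if $O_1\neq O_2$ are paired and $\sigma(O_1)=O_2$. -}

module Defs where

open import Level using (Level; _⊔_) renaming (suc to lsuc; zero to lzero)
open import Data.Nat using (ℕ)
open import Data.Fin using (Fin)
open import Data.Product using (Σ; ∃; ∃-syntax; _×_; _,_)
open import Data.Sum using (_⊎_)
open import Relation.Nullary using (¬_)
open import Relation.Binary.PropositionalEquality using (_≡_; _≢_)
open import Function.Bundles using (_↔_; Inverse; _⇔_)
open import Function.Construct.Identity using (↔-id)
open import Function.Construct.Composition using (_↔-∘_)
open import Function.Construct.Symmetry using (↔-sym)

Perm : Set → Set
Perm X = X ↔ X

module _ {X : Set} where
  app : Perm X → X → X
  app σ = Inverse.to σ

  app⁻¹ : Perm X → X → X
  app⁻¹ σ = Inverse.from σ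

_≗ₚ_ : {X : Set} → Perm X → Perm X → Set
σ ≗ₚ τ = ∀ x → app σ x ≡ app τ x

PermSet : Set → Set₁
PermSet X = Perm X → Set

record PermGroup (X : Set) : Set₁ where
  field
    mem   : PermSet X
    resp  : ∀ {σ τ} → σ ≗ₚ τ → mem σ → mem τ
    id∈   : mem (↔-id X)
    comp∈ : ∀ {σ τ} → mem σ → mem τ → mem (σ ↔-∘ τ)
    inv∈  : ∀ {σ} → mem σ → mem (↔-sym σ)
open PermGroup public

-- An edge-coloured digraph on X: a colour for each ordered pair of distinct
-- vertices (the values on the diagonal are irrelevant).
Digraph : Set → ℕ → Set
Digraph X k = X → X → Fin k

-- An edge-coloured graph: a colour for each 2-element subset {u,u'},
-- represented as a digraph colouring symmetric on distinct vertices.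
IsSymmetric : {X : Set} {k : ℕ} → Digraph X k → Set
IsSymmetric {X} E = ∀ (u u' : X) → u ≢ u' → E u u' ≡ E u' u

IsAut : {X : Set} {k : ℕ} → Digraph X k → Perm X → Set
IsAut {X} E σ = ∀ (u u' : X) → u ≢ u' → E (app σ u) (app σ u') ≡ E u u'

IsAutGroupOf : {X : Set} {k : ℕ} → PermSet X → Digraph X k → Set
IsAutGroupOf P E = ∀ σ → (P σ → IsAut E σ) × (IsAut E σ → P σ)

InGR : {X : Set} → PermSet X → Set
InGR {X} P = ∃[ k ] Σ (Digraph X k) (λ E → IsSymmetric E × IsAutGroupOf P E)

InDGR : {X : Set} → PermSet X → Set
InDGR {X} P = ∃[ k ] Σ (Digraph X k) (λ E → IsAutGroupOf P E)

-- (A,V) is permutation isomorphic to I₂ (V = Fin n): |V| = 2 and A trivial.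
IsI₂ : {n : ℕ} → PermSet (Fin n) → Set
IsI₂ {n} P = (n ≡ 2) × (∀ σ → P σ → ∀ x → app σ x ≡ x)

SameOr : {X : Set} → PermSet X → X → X → X → X → Set
SameOr P v v' u u' = ∃[ a ] (P a × app a v ≡ u × app a v' ≡ u')

SameNOr : {X : Set} → PermSet X → X → X → X → X → Set
SameNOr P v v' u u' =
  ∃[ a ] (P a × ((app a v ≡ u × app a v' ≡ u') ⊎ (app a v ≡ u' × app a v' ≡ u)))

-- σ ∈ Ā: σ maps every NOr-orbital of P onto itself
-- (image contained in it, and every element of it has its preimage in it).
InBar : {X : Set} → PermSet X → PermSet X
InBar {X} P σ = ∀ (v v' : X) → v ≢ v' →
  SameNOr P v v' (app σ v) (app σ v') × SameNOr P v v' (app⁻¹ σ v) (app⁻¹ σ v')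

InPrime : {X : Set} → PermSet X → PermSet X
InPrime P σ = InBar P σ × ¬ P σ

MapsOrbOnto : {X : Set} → PermSet X → Perm X → X → X → X → X → Set
MapsOrbOnto {X} P σ v v' w w' =
  (∀ (u u' : X) → SameOr P v v' u u' → SameOr P w w' (app σ u) (app σ u'))
  × (∀ (u u' : X) → SameOr P w w' u u' → SameOr P v v' (app⁻¹ σ u) (app⁻¹ σ u'))

-- σ pairs every pair {O₁,O₂} of distinct paired Or-orbitals of P:
-- for O₁ the orbital of (v,v') and O₂ that of (v',v), with O₁ ≠ O₂,
-- σ(O₁) = O₂ or σ(O₂) = O₁.
PairsAll : {X : Set} → PermSet X → Perm X → Set
PairsAll {X} P σ = ∀ (v v' : X) → v ≢ v' → ¬ SameOr P v v' v' v →
  MapsOrbOnto P σ v v' v' v ⊎ MapsOrbOnto P σ v' v v v'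

ProdSet : {X Y : Set} → PermSet X → PermSet Y → PermSet (X × Y)
ProdSet {X} {Y} P Q τ = ∃[ a ] ∃[ b ] (P a × Q b ×
  (∀ (x : X) (y : Y) → app τ (x , y) ≡ (app a x , app b y)))

IsTransitive : {X : Set} → PermSet X → Set
IsTransitive {X} P = ∀ (x y : X) → ∃[ σ ] (P σ × app σ x ≡ y)

-- The element a ∈ Ā ∖ A reverses every pair up to A: for v ≠ v' some α ∈ A maps
-- (v,v') to (a v', a v). If the Or-orbital of (v,v') is not self-paired this is the
-- pairing hypothesis; otherwise a preserves the NOr-orbital of {v,v'}, and an element
-- of A swapping v and v' corrects it if necessary. This forces A to be transitive:
-- if x and y lie in different orbits, both orbits are singletons and a maps x to y
-- and to every other point, so V = {x,y} and A = I₂.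
-- Now let E be a symmetric colouring of V × W with Aut E = A × B. For each pair of
-- points p ≠ p', (a × b)(p, p') is the reverse of (α × β)(p, p') for some α × β ∈ A × B,
-- so by symmetry a × b preserves E. Hence a × b ∈ A × B and a ∈ A, a contradiction.
-- Constructively, the case distinctions on orbitals are decidable because A = Aut Eᴬ
-- for a digraph Eᴬ on a finite set: one can search all permutations.

module Submission where

open import Defs
open import Data.Nat using (ℕ; zero; suc)
open import Data.Fin using (Fin; zero; suc; _≟_)
open import Data.Fin.Properties using (any?; all?; cantor-schröder-bernstein)
open import Data.Product using (∃-syntax; _×_; ∃; _,_; proj₁; proj₂)
open import Data.Vec.Functional using (_∷_; head; tail)
open import Data.Vec.Functional.Properties using (∷-cong)
open import Data.Product.Function.NonDependent.Propositional using (_×-↔_)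
open import Data.Sum using (_⊎_; inj₁; inj₂)
open import Relation.Nullary using (¬_; Dec; yes; no; contradiction)
open import Relation.Nullary.Decidable using (_×-dec_; _→-dec_; ¬?; map′)
open import Relation.Binary.Definitions using (_Respects_)
open import Relation.Binary.PropositionalEquality
  using (_≡_; _≢_; _≗_; refl; sym; trans; cong; cong₂; module ≡-Reasoning)
open import Function.Bundles using (Inverse; Injection; mk↔ₛ′)
open import Function.Properties.Inverse using (↔⇒↣)
open import Function.Construct.Identity using (↔-id)
open import Function.Construct.Composition using (_↔-∘_)
open import Function.Construct.Symmetry using (↔-sym)
open Inverse using (to; from; strictlyInverseˡ; strictlyInverseʳ)

∃-map? : ∀ n {m} (P : (Fin n → Fin m) → Set) → P Respects _≗_ →
         (∀ f → Dec (P f)) → Dec (∃ P)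
∃-map? zero P P-resp P? with P? (λ ())
... | yes p  = yes (_ , p)
... | no ¬p = no λ (f , pf) → ¬p (P-resp (λ ()) pf)
∃-map? (suc n) P P-resp P?
  with any? (λ x → ∃-map? n (λ f → P (x ∷ f)) (λ f≗g → P-resp (∷-cong refl f≗g)) (λ f → P? (x ∷ f)))
... | yes (x , f , p) = yes (x ∷ f , p)
... | no ¬p = no λ (f , pf) → ¬p (head f , tail f , P-resp (∷-cong refl (λ _ → refl)) pf)

HasInverse : ∀ {n} → (Fin n → Fin n) → (Fin n → Fin n) → Set
HasInverse f g = (∀ x → g (f x) ≡ x) × (∀ y → f (g y) ≡ y)

∃-perm? : ∀ {n} (R : (Fin n → Fin n) → Set) → R Respects _≗_ →
          (∀ f → Dec (R f)) → Dec (∃ λ σ → R (app σ))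
∃-perm? {n} R R-resp R? with ∃-map? n Candidate Candidate-resp Candidate?
  where
  Candidate : (Fin n → Fin n) → Set
  Candidate f = (∃ λ g → HasInverse f g) × R f

  Candidate-resp : Candidate Respects _≗_
  Candidate-resp {f} {f'} f≗f' ((g , gf , fg) , r) =
      (g , (λ x → trans (cong g (sym (f≗f' x))) (gf x)) , (λ y → trans (sym (f≗f' (g y))) (fg y)))
    , R-resp f≗f' r

  Candidate? : ∀ f → Dec (Candidate f)
  Candidate? f = ∃-map? n (HasInverse f) inverse-resp inverse? ×-dec R? f
    where
    inverse-resp : HasInverse f Respects _≗_
    inverse-resp g≗g' (gf , fg) = (λ x → trans (sym (g≗g' (f x))) (gf x))
                                , (λ y → trans (cong f (sym (g≗g' y))) (fg y))
    inverse? : ∀ g → Dec (HasInverse f g)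
    inverse? g = all? (λ x → g (f x) ≟ x) ×-dec all? (λ y → f (g y) ≟ y)
... | yes (f , (g , gf , fg) , r) = yes (mk↔ₛ′ f g fg gf , r)
... | no ¬c = no λ (σ , r) → ¬c (to σ , (from σ , strictlyInverseʳ σ , strictlyInverseˡ σ) , r)

module _ {n k : ℕ} (E : Digraph (Fin n) k) where

  IsAutMap : (Fin n → Fin n) → Set
  IsAutMap f = ∀ u u' → u ≢ u' → E (f u) (f u') ≡ E u u'

  IsAutMap? : ∀ f → Dec (IsAutMap f)
  IsAutMap? f = all? λ u → all? λ u' → ¬? (u ≟ u') →-dec (E (f u) (f u') ≟ E u u')

  IsAutMap-resp : IsAutMap Respects _≗_
  IsAutMap-resp f≗g aut u u' u≢u' = trans (cong₂ E (sym (f≗g u)) (sym (f≗g u'))) (aut u u' u≢u')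

SameOr? : ∀ {n k} {P : PermSet (Fin n)} (E : Digraph (Fin n) k) → IsAutGroupOf P E →
          ∀ v v' u u' → Dec (SameOr P v v' u u')
SameOr? {n} E P-aut v v' u u' =
  map′ (λ (σ , aut , q) → σ , proj₂ (P-aut σ) aut , q)
       (λ (σ , σ∈P , q) → σ , proj₁ (P-aut σ) σ∈P , q)
       (∃-perm? R R-resp (λ f → IsAutMap? E f ×-dec (f v ≟ u) ×-dec (f v' ≟ u')))
  where
  R : (Fin n → Fin n) → Set
  R f = IsAutMap E f × f v ≡ u × f v' ≡ u'

  R-resp : R Respects _≗_
  R-resp f≗g (aut , fv , fv') = IsAutMap-resp E f≗g aut , trans (sym (f≗g v)) fv , trans (sym (f≗g v')) fv'

SameOrbit : {X : Set} → PermSet X → X → X → Set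
SameOrbit P x y = ∃[ σ ] (P σ × app σ x ≡ y)

Reverses : {X : Set} → PermSet X → Perm X → X → X → Set
Reverses P σ v v' = SameOr P v v' (app σ v') (app σ v)

SameOr-swap : ∀ {X} {P : PermSet X} {v v' u u' : X} → SameOr P v v' u u' → SameOr P v' v u' u
SameOr-swap (σ , σ∈P , σv , σv') = σ , σ∈P , σv' , σv

module Orbits {X : Set} (A : PermGroup X) where

  _∼_ : X → X → Set
  _∼_ = SameOrbit (mem A)

  ∼-refl : ∀ {x} → x ∼ x
  ∼-refl = ↔-id _ , id∈ A , refl

  ∼-sym : ∀ {x y} → x ∼ y → y ∼ x
  ∼-sym {x} (σ , σ∈A , σx) = ↔-sym σ , inv∈ A σ∈A , trans (cong (from σ) (sym σx)) (strictlyInverseʳ σ x)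

  ∼-trans : ∀ {x y z} → x ∼ y → y ∼ z → x ∼ z
  ∼-trans (σ , σ∈A , σx) (τ , τ∈A , τy) = τ ↔-∘ σ , comp∈ A τ∈A σ∈A , trans (cong (to τ) σx) τy

  ≁⇒≢ : ∀ {x y} → ¬ x ∼ y → x ≢ y
  ≁⇒≢ x≁y refl = x≁y ∼-refl

  SameOr-refl : ∀ v v' → SameOr (mem A) v v' v v'
  SameOr-refl v v' = ↔-id _ , id∈ A , refl , refl

covered-by-two⇒≡2 : ∀ {n} {x y : Fin n} → x ≢ y → (∀ u → u ≡ x ⊎ u ≡ y) → n ≡ 2
covered-by-two⇒≡2 {n} {x} {y} x≢y cover = cantor-schröder-bernstein index-injective pair-injective
  where
  index : Fin n → Fin 2
  index u with cover u
  ... | inj₁ _ = zero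
  ... | inj₂ _ = suc zero

  index-injective : ∀ {u u'} → index u ≡ index u' → u ≡ u'
  index-injective {u} {u'} eq with cover u | cover u'
  ... | inj₁ u≡x | inj₁ u'≡x = trans u≡x (sym u'≡x)
  ... | inj₂ u≡y | inj₂ u'≡y = trans u≡y (sym u'≡y)
  index-injective () | inj₁ _ | inj₂ _
  index-injective () | inj₂ _ | inj₁ _

  pair : Fin 2 → Fin n
  pair zero    = x
  pair (suc _) = y

  pair-injective : ∀ {i j} → pair i ≡ pair j → i ≡ j
  pair-injective {zero}        {zero}        _   = refl
  pair-injective {zero}        {suc zero}    x≡y = contradiction x≡y x≢y
  pair-injective {suc zero}    {zero}        y≡x = contradiction (sym y≡x) x≢y
  pair-injective {suc zero}    {suc zero}    _   = refl

module Reversal {n : ℕ} (A : PermGroup (Fin n))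
  (SameOrᴬ? : ∀ v v' u u' → Dec (SameOr (mem A) v v' u u'))
  (a : Perm (Fin n)) (a∈Ā : InBar (mem A) a) (a-pairs : PairsAll (mem A) a) where

  open Orbits A

  reverses-distinct : ∀ {v v'} → v ≢ v' → Reverses (mem A) a v v'
  reverses-distinct {v} {v'} v≢v' with SameOrᴬ? v v' v' v
  ... | yes (γ , γ∈A , γv , γv') with proj₁ (a∈Ā v v' v≢v')
  ...   | β , β∈A , inj₁ (βv , βv') =
            β ↔-∘ γ , comp∈ A β∈A γ∈A , trans (cong (to β) γv) βv' , trans (cong (to β) γv') βv
  ...   | β , β∈A , inj₂ (βv , βv') = β , β∈A , βv , βv'
  reverses-distinct {v} {v'} v≢v' | no notSelfPaired with a-pairs v v' v≢v' notSelfPaired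
  ... | inj₁ onto = SameOr-swap (proj₁ onto v v' (SameOr-refl v v'))
  ... | inj₂ onto = proj₁ onto v' v (SameOr-refl v' v)

  ∼? : ∀ x y → Dec (x ∼ y)
  ∼? x y = map′ (λ (σ , σ∈A , σx , _) → σ , σ∈A , σx)
                (λ (σ , σ∈A , σx) → σ , σ∈A , σx , σx)
                (SameOrᴬ? x x y y)

  ≁⇒∼-image : ∀ {x y} → ¬ x ∼ y → y ∼ app a x
  ≁⇒∼-image x≁y with reverses-distinct (≁⇒≢ x≁y)
  ... | σ , σ∈A , _ , σy = σ , σ∈A , σy

  ∼-image : ∀ {x u} → u ≢ x → x ∼ u → x ∼ app a x
  ∼-image {x} {u} u≢x x∼u with proj₁ (a∈Ā x u (λ x≡u → u≢x (sym x≡u)))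
  ... | β , β∈A , inj₁ (βx , _) = β , β∈A , βx
  ... | β , β∈A , inj₂ (_ , βu) = ∼-trans x∼u (β , β∈A , βu)

  ≁⇒orbit-trivial : ∀ {x y} → ¬ x ∼ y → ∀ {u} → x ∼ u → u ≡ x
  ≁⇒orbit-trivial {x} x≁y {u} x∼u with u ≟ x
  ... | yes u≡x = u≡x
  ... | no u≢x = contradiction (∼-trans (∼-image u≢x x∼u) (∼-sym (≁⇒∼-image x≁y))) x≁y

  ≁⇒image : ∀ {x y} → ¬ x ∼ y → app a x ≡ y
  ≁⇒image x≁y = ≁⇒orbit-trivial (λ y∼x → x≁y (∼-sym y∼x)) (≁⇒∼-image x≁y)

  ≁⇒covered : ∀ {x y} → ¬ x ∼ y → ∀ u → u ≡ x ⊎ u ≡ y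
  ≁⇒covered {x} x≁y u with u ≟ x
  ... | yes u≡x = inj₁ u≡x
  ... | no u≢x = inj₂ (trans (sym (≁⇒image x≁u)) (≁⇒image x≁y))
    where
    x≁u : ¬ x ∼ u
    x≁u x∼u = u≢x (≁⇒orbit-trivial x≁y x∼u)

  ≁⇒I₂ : ∀ {x y} → ¬ x ∼ y → IsI₂ (mem A)
  ≁⇒I₂ {x} {y} x≁y = covered-by-two⇒≡2 (≁⇒≢ x≁y) (≁⇒covered x≁y) , fixes
    where
    fixes : ∀ σ → mem A σ → ∀ u → app σ u ≡ u
    fixes σ σ∈A u with ≁⇒covered x≁y u
    ... | inj₁ refl = ≁⇒orbit-trivial x≁y (σ , σ∈A , refl)
    ... | inj₂ refl = ≁⇒orbit-trivial (λ y∼x → x≁y (∼-sym y∼x)) (σ , σ∈A , refl)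

  transitive : ¬ IsI₂ (mem A) → IsTransitive (mem A)
  transitive ¬I₂ x y with ∼? x y
  ... | yes x∼y = x∼y
  ... | no x≁y = contradiction (≁⇒I₂ x≁y) ¬I₂

  reverses : ¬ IsI₂ (mem A) → ∀ v v' → Reverses (mem A) a v v'
  reverses ¬I₂ v v' with v ≟ v'
  ... | no v≢v' = reverses-distinct v≢v'
  ... | yes refl with transitive ¬I₂ v (app a v)
  ...   | σ , σ∈A , σv = σ , σ∈A , σv , σv

×-transitive : ∀ {V W : Set} {P : PermSet V} {Q : PermSet W} →
               IsTransitive P → IsTransitive Q → IsTransitive (ProdSet P Q)
×-transitive P-trans Q-trans (v , w) (v' , w') with P-trans v v' | Q-trans w w'
... | α , α∈P , αv | β , β∈Q , βw =
  (α ×-↔ β) , (α , β , α∈P , β∈Q , λ _ _ → refl) , cong₂ _,_ αv βw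

module _ {V W : Set} {P : PermSet V} {Q : PermSet W} {k : ℕ} (E : Digraph (V × W) k)
  (E-sym : IsSymmetric E) (E-aut : IsAutGroupOf (ProdSet P Q) E) where

  reversing-×-aut : ∀ a b → (∀ v v' → Reverses P a v v') → (∀ w w' → Reverses Q b w w') →
                    IsAut E (a ×-↔ b)
  reversing-×-aut a b a-rev b-rev p@(v , w) p'@(v' , w') p≢p'
    with a-rev v v' | b-rev w w'
  ... | α , α∈P , αv , αv' | β , β∈Q , βw , βw' = begin
    E (app a v , app b w) (app a v' , app b w')
      ≡⟨ cong₂ E (cong₂ _,_ (sym αv') (sym βw')) (cong₂ _,_ (sym αv) (sym βw)) ⟩
    E (app τ p') (app τ p)
      ≡⟨ E-sym _ _ (λ τp'≡τp → p≢p' (sym (Injection.injective (↔⇒↣ τ) τp'≡τp))) ⟩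
    E (app τ p) (app τ p')
      ≡⟨ proj₁ (E-aut τ) (α , β , α∈P , β∈Q , λ _ _ → refl) p p' p≢p' ⟩
    E p p' ∎
    where
    open ≡-Reasoning
    τ = α ×-↔ β

¬InGR-× : ∀ {V W : Set} (A : PermGroup V) {Q : PermSet W} a b → ¬ mem A a → W →
          (∀ v v' → Reverses (mem A) a v v') → (∀ w w' → Reverses Q b w w') →
          ¬ InGR (ProdSet (mem A) Q)
¬InGR-× A a b a∉A w₀ a-rev b-rev (_ , E , E-sym , E-aut)
  with proj₂ (E-aut (a ×-↔ b)) (reversing-×-aut E E-sym E-aut a b a-rev b-rev)
... | a' , _ , a'∈A , _ , a×b≡a'×b' = a∉A (resp A (λ v → cong proj₁ (sym (a×b≡a'×b' v w₀))) a'∈A)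

point-outside : ∀ {m} (B : PermGroup (Fin m)) {b} → ¬ mem B b → Fin m
point-outside {zero}  B b∉B = contradiction (resp B (λ ()) (id∈ B)) b∉B
point-outside {suc _} B b∉B = zero

lemma3p14 : (n m : ℕ) (A : PermGroup (Fin n)) (B : PermGroup (Fin m)) →
    InDGR (mem A) → ¬ (InGR (mem A) ⊎ IsI₂ (mem A)) →
    InDGR (mem B) → ¬ (InGR (mem B) ⊎ IsI₂ (mem B)) →
    ∃[ a ] (InPrime (mem A) a × PairsAll (mem A) a) →
    ∃[ b ] (InPrime (mem B) b × PairsAll (mem B) b) →
    ¬ InGR (ProdSet (mem A) (mem B)) × IsTransitive (ProdSet (mem A) (mem B))
lemma3p14 n m A B (_ , Eᴬ , A-aut) A-excluded (_ , Eᴮ , B-aut) B-excluded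
          (a , (a∈Ā , a∉A) , a-pairs) (b , (b∈B̄ , b∉B) , b-pairs) =
    ¬InGR-× A a b a∉A (point-outside B b∉B) (RA.reverses ¬I₂ᴬ) (RB.reverses ¬I₂ᴮ)
  , ×-transitive (RA.transitive ¬I₂ᴬ) (RB.transitive ¬I₂ᴮ)
  where
  module RA = Reversal A (SameOr? Eᴬ A-aut) a a∈Ā a-pairs
  module RB = Reversal B (SameOr? Eᴮ B-aut) b b∈B̄ b-pairs

  ¬I₂ᴬ : ¬ IsI₂ (mem A)
  ¬I₂ᴬ = λ I₂ → A-excluded (inj₂ I₂)

  ¬I₂ᴮ : ¬ IsI₂ (mem B)
  ¬I₂ᴮ = λ I₂ → B-excluded (inj₂ I₂)
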